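{- Let $k\ge1$ and let $G$ be a graph with $n$ vertices such that its complement $\overline{G}$ is $k$-degenerate. Then $\mathrm{boolw}(G)\le k\log_2 n$.
   Context: A graph $H$ is $k$-degenerate if there is an ordering of its vertices such that every vertex has at most $k$ neighbours appearing later in the ordering. For $A\subseteq V(G)$ write $\overline{A}=V(G)\setminus A$. A decomposition tree of $G$ is a pair $(T,\delta)$ where $T$ is a tree whose internal nodes have degree three and which has $|V(G)|$ leaves, and $\delta$ is a bijection between $V(G)$ and the leaves of $T$; each edge of $T$ defines a cut $\{A,\overline{A}\}$ given by the leaves of the two components of $T$ minus that edge. Define $\mathrm{cut\text{ - }bool}(A)=\log_2|\{S\subseteq\overline{A} : \exists X\subseteq A,\ S=\overline{A}\cap\bigcup_{x\in X}N(x)\}|$. The boolean-width of $(T,\delta)$ is the maximum of $\mathrm{cut\text{ - }bool}(A)$ over cuts given by edges of $T$, and $\mathrm{boolw}(G)$ is the minimum over all decomposition trees of $G$. -}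

module Defs where

open import Data.Nat using (ℕ; zero; suc; _≤_; _<_)
open import Data.Bool using (Bool; true; false; not; _∧_; _∨_; if_then_else_)
open import Data.Bool.Properties using () renaming (_≟_ to _≟ᵇ_)
open import Data.Fin using (Fin)
open import Data.Fin.Properties using () renaming (_≟_ to _≟ᶠ_)
open import Data.Fin.Subset using (Subset; ∣_∣)
open import Data.Vec using (Vec; []; _∷_; lookup; tabulate)
open import Data.Vec.Properties using (≡-dec)
open import Data.List using (List; []; _∷_; _++_; map; length; filterᵇ; allFin)
open import Data.Bool.ListAction using (any; all)
open import Data.Product using (Σ; _×_; _,_; ∃)
open import Data.Sum using (_⊎_)
open import Relation.Nullary using (¬_; does)
open import Relation.Binary.PropositionalEquality using (_≡_)
open import Function.Definitions using (Injective)

record Graph (n : ℕ) : Set where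
  field
    adj   : Fin n → Fin n → Bool
    adj-sym : ∀ x y → adj x y ≡ adj y x
    adj-irrefl : ∀ x → adj x x ≡ false
open Graph public

complement : ∀ {n} → Graph n → Graph n
complement {n} G = record { adj = cadj ; adj-sym = csym ; adj-irrefl = cirr }
  where
  open import Relation.Binary.PropositionalEquality using (refl; cong; sym)
  open import Relation.Nullary using (yes; no)
  cadj : Fin n → Fin n → Bool
  cadj x y = not (does (x ≟ᶠ y)) ∧ not (adj G x y)
  csym : ∀ x y → cadj x y ≡ cadj y x
  csym x y with x ≟ᶠ y | y ≟ᶠ x
  ... | yes _ | yes _ = refl
  ... | no _  | no _  = cong not (adj-sym G x y)
  ... | yes p | no q  = Data.Empty.⊥-elim (q (sym p)) where import Data.Empty
  ... | no p  | yes q = Data.Empty.⊥-elim (p (sym q)) where import Data.Empty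
  cirr : ∀ x → cadj x x ≡ false
  cirr x with x ≟ᶠ x
  ... | yes _ = refl
  ... | no ¬p = Data.Empty.⊥-elim (¬p refl) where import Data.Empty

countᶠ : ∀ {n} → (Fin n → Bool) → ℕ
countᶠ p = ∣ tabulate p ∣

-- k-degeneracy: an ordering (pos x = position of x; pos injective, hence a
-- bijection Fin n → Fin n) such that every vertex has at most k neighbours
-- appearing later in the ordering.

laterNbrs : ∀ {n} → Graph n → (Fin n → Fin n) → Fin n → ℕ
laterNbrs G pos v = countᶠ (λ u → adj G v u ∧ does (Data.Fin._<?_ (pos v) (pos u)))
  where import Data.Fin

Degenerate : ∀ {n} → ℕ → Graph n → Set
Degenerate {n} k G =
  Σ (Fin n → Fin n) λ pos → Injective _≡_ _≡_ pos × (∀ v → laterNbrs G pos v ≤ k)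

anyᶠ : ∀ {n} → (Fin n → Bool) → Bool
anyᶠ {n} p = any p (allFin n)

allᶠ : ∀ {n} → (Fin n → Bool) → Bool
allᶠ {n} p = all p (allFin n)

allSubsets : (n : ℕ) → List (Subset n)
allSubsets zero    = [] ∷ []
allSubsets (suc n) = map (true ∷_) (allSubsets n) ++ map (false ∷_) (allSubsets n)

subsetᵇ : ∀ {n} → Subset n → Subset n → Bool
subsetᵇ X A = allᶠ (λ x → not (lookup X x) ∨ lookup A x)

nbrUnion : ∀ {n} → Graph n → Subset n → Subset n → Subset n
nbrUnion G A X = tabulate λ y → not (lookup A y) ∧ anyᶠ (λ x → lookup X x ∧ adj G x y)

realizable : ∀ {n} → Graph n → Subset n → Subset n → Bool
realizable {n} G A S =
  any (λ X → subsetᵇ X A ∧ does (≡-dec _≟ᵇ_ (nbrUnion G A X) S)) (allSubsets n)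

-- |{ S ⊆ Ā : ∃ X ⊆ A, S = Ā ∩ ⋃_{x∈X} N(x) }|;  cut-bool(A) = log₂ of this.
cutBoolCount : ∀ {n} → Graph n → Subset n → ℕ
cutBoolCount {n} G A = length (filterᵇ (realizable G A) (allSubsets n))

record SGraph (m : ℕ) : Set where
  field
    tadj    : Fin m → Fin m → Bool
    tsym    : ∀ a b → tadj a b ≡ tadj b a
    tirrefl : ∀ a → tadj a a ≡ false
open SGraph public

SameEdge : ∀ {m} → Fin m → Fin m → Fin m → Fin m → Set
SameEdge a b u v = (a ≡ u × b ≡ v) ⊎ (a ≡ v × b ≡ u)

data ReachAvoid {m} (T : SGraph m) (u v : Fin m) : Fin m → Fin m → Set where
  here : ∀ {a} → ReachAvoid T u v a a
  step : ∀ {a b c} → tadj T a b ≡ true → ¬ SameEdge a b u v →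
         ReachAvoid T u v b c → ReachAvoid T u v a c

data Reach {m} (T : SGraph m) : Fin m → Fin m → Set where
  here : ∀ {a} → Reach T a a
  step : ∀ {a b c} → tadj T a b ≡ true → Reach T b c → Reach T a c

-- A tree: connected, and every edge is a bridge (i.e. connected and acyclic).
IsTree : ∀ {m} → SGraph m → Set
IsTree {m} T = (∀ a b → Reach T a b)
             × (∀ u v → tadj T u v ≡ true → ¬ ReachAvoid T u v u v)

tdeg : ∀ {m} → SGraph m → Fin m → ℕ
tdeg T a = countᶠ (tadj T a)

IsLeaf : ∀ {m} → SGraph m → Fin m → Set
IsLeaf T a = tdeg T a ≤ 1

record DecompTree (n : ℕ) : Set where
  field
    m       : ℕ
    T       : SGraph m
    isTree  : IsTree T
    degrees : ∀ a → IsLeaf T a ⊎ tdeg T a ≡ 3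
    δ       : Fin n → Fin m
    δ-inj   : Injective _≡_ _≡_ δ
    δ-leaf  : ∀ x → IsLeaf T (δ x)
    δ-onto  : ∀ a → IsLeaf T a → ∃ λ x → δ x ≡ a
open DecompTree public

-- A is the cut side of the T-edge u–v containing u: the vertices of G whose
-- leaf lies in the component of T − uv containing u.
IsCutOf : ∀ {n} (D : DecompTree n) → Fin (m D) → Fin (m D) → Subset n → Set
IsCutOf D u v A = ∀ x → (lookup A x ≡ true → ReachAvoid (T D) u v u (δ D x))
                      × (ReachAvoid (T D) u v u (δ D x) → lookup A x ≡ true)

-- Every cut of (T,δ) has cut-bool at most log₂ B, i.e. at most B realizable sets.
-- (boolw(G) ≤ log₂ B  iff  some decomposition tree satisfies this.)
BoolWidthAtMostLog : ∀ {n} → Graph n → DecompTree n → ℕ → Set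
BoolWidthAtMostLog {n} G D B =
  ∀ (u v : Fin (m D)) → tadj (T D) u v ≡ true →
  ∀ (A : Subset n) → IsCutOf D u v A → cutBoolCount G A ≤ B

module Submission where

-- Let π be an ordering of V(G) in which every vertex has at most k non-neighbours (in G)
-- after it.  Put the vertices, in the order π, on the leaves of a caterpillar (a path with
-- a pendant leaf at each node).  Each edge of the caterpillar cuts off a single leaf, or
-- splits π into an initial segment of at least two vertices and the final rest.  For a
-- cut side A:
--   * if A or Ā has at most one vertex, there are at most 2 traces;
--   * if A is an initial segment, the trace of a nonempty X ⊆ A is Ā minus at most k later
--     non-neighbours of any x ∈ X, so it is coded by a k-tuple;
--   * if A is a final segment, every X ⊆ A with more than k vertices dominates Ā, so the
--     traces come from sets X of at most k vertices, again coded by k-tuples.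

open import Data.Nat using (ℕ; zero; suc; _+_; _*_; _∸_; _^_; _≤_; _<_; z≤n; s≤s; z<s; s<s; s≤s⁻¹; _≤?_; _<?_; _≡ᵇ_; _<ᵇ_)
open import Data.Nat.Properties
open import Data.Bool using (Bool; true; false; not; _∧_; _∨_; if_then_else_) renaming (T to IsTrue)
open import Data.Bool.Properties using (T-≡; ∧-conicalˡ; ∧-conicalʳ; not-involutive; not-injective; ∨-comm; ∨-identityʳ; ∧-identityʳ; ∧-zeroʳ) renaming (T? to T-dec; _≟_ to _≟ᵇ_)
open import Data.Fin using (Fin; zero; suc; toℕ; fromℕ; fromℕ<; _↑ˡ_; _↑ʳ_; splitAt; join; punchOut; inject₁)
open import Data.Fin.Properties using (toℕ-injective; toℕ<n; toℕ-fromℕ; toℕ-fromℕ<; toℕ-inject₁; join-splitAt; splitAt-↑ˡ; splitAt-↑ʳ; any?; pigeonhole; punchOut-injective) renaming (_≟_ to _≟ᶠ_; _<?_ to _<ᶠ?_; <⇒≢ to <ᶠ⇒≢)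
open import Data.Fin.Subset using (Subset; ∣_∣)
open import Data.Fin.Subset.Properties using (p⊆q⇒∣p∣≤∣q∣)
open import Data.Vec using ([]; _∷_; lookup; tabulate)
open import Data.Vec.Properties using (lookup∘tabulate; tabulate∘lookup; tabulate-cong; []=⇒lookup; lookup⇒[]=; ≡-dec)
open import Data.List using (List; []; _∷_; _++_; map; length; filterᵇ; allFin; concatMap; replicate)
import Data.List as List
open import Data.List.Properties using (length-++; length-map; length-replicate; length-tabulate) renaming (≡-dec to ≡-decᴸ)
open import Data.Bool.ListAction using (any; all)
open import Data.List.Membership.Propositional using (_∈_)
open import Data.List.Membership.Propositional.Properties using (∈-filter⁻; ∈-filter⁺; ∈-allFin; ∈-concatMap⁺; ∈-map⁺; ∈-map⁻; ∈-++⁻; ∈-++⁺ˡ)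
open import Data.List.Relation.Unary.Any as Any using (here; there; satisfied)
open import Data.List.Relation.Unary.Any.Properties using (any⁺; any⁻)
open import Data.List.Relation.Unary.All as All using (All; []; _∷_)
open import Data.List.Relation.Unary.All.Properties using (all⁺; replicate⁺)
open import Data.List.Relation.Unary.AllPairs using ([]; _∷_)
open import Data.List.Relation.Unary.Unique.Propositional using (Unique)
import Data.List.Relation.Unary.Unique.Propositional.Properties as Unique
open import Data.Product using (Σ; _×_; _,_; ∃; proj₁; proj₂)
open import Data.Sum using (_⊎_; inj₁; inj₂)
open import Data.Sum.Properties using (inj₁-injective)
open import Data.Empty using (⊥; ⊥-elim)
open import Function using (_∘_)
open import Function.Bundles using (Equivalence)
open import Function.Definitions using (Injective)
open import Relation.Nullary using (¬_; Dec; does; yes; no)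
open import Relation.Nullary.Decidable using (isYes; toWitness; fromWitness; _×-dec_; _⊎-dec_)
open import Relation.Binary.PropositionalEquality

open import Defs

true≢false : true ≢ false
true≢false ()

≡true⇒T : ∀ {b} → b ≡ true → IsTrue b
≡true⇒T = Equivalence.from T-≡

T⇒≡true : ∀ {b} → IsTrue b → b ≡ true
T⇒≡true = Equivalence.to T-≡

bool-ext : ∀ {b c : Bool} → (b ≡ true → c ≡ true) → (c ≡ true → b ≡ true) → b ≡ c
bool-ext {false} {false} _ _ = refl
bool-ext {false} {true}  _ g = g refl
bool-ext {true}  {false} f _ = sym (f refl)
bool-ext {true}  {true}  _ _ = refl

subset-ext : ∀ {n} (X : Subset n) (f : Fin n → Bool) → (∀ x → lookup X x ≡ f x) → X ≡ tabulate f
subset-ext X f h = trans (sym (tabulate∘lookup X)) (tabulate-cong h)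

module _ {n : ℕ} where

  anyᶠ-witness : (p : Fin n → Bool) → anyᶠ p ≡ true → ∃ λ x → p x ≡ true
  anyᶠ-witness p e with satisfied (any⁻ p (allFin n) (≡true⇒T e))
  ... | x , px = x , T⇒≡true px

  anyᶠ-intro : (p : Fin n → Bool) (x : Fin n) → p x ≡ true → anyᶠ p ≡ true
  anyᶠ-intro p x px = T⇒≡true (any⁺ p (Any.map (λ { refl → ≡true⇒T px }) (∈-allFin x)))

  anyᶠ-false : (p : Fin n → Bool) → anyᶠ p ≡ false → ∀ x → p x ≡ false
  anyᶠ-false p e x with p x in px
  ... | false = refl
  ... | true  = ⊥-elim (true≢false (trans (sym (anyᶠ-intro p x px)) e))

  allᶠ-elim : (p : Fin n → Bool) → allᶠ p ≡ true → ∀ x → p x ≡ true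
  allᶠ-elim p e x = T⇒≡true (All.lookup (all⁺ p (allFin n) (≡true⇒T e)) (∈-allFin x))

  countᶠ-mono : (p q : Fin n → Bool) → (∀ x → p x ≡ true → q x ≡ true) → countᶠ p ≤ countᶠ q
  countᶠ-mono p q h = p⊆q⇒∣p∣≤∣q∣ {p = tabulate p} {q = tabulate q} λ {x} x∈p →
    lookup⇒[]= x (tabulate q)
      (trans (lookup∘tabulate q x) (h x (trans (sym (lookup∘tabulate p x)) ([]=⇒lookup x∈p))))

length-filter-tabulate : ∀ {A : Set} {n} (f : Fin n → A) (p : A → Bool) →
  length (filterᵇ p (List.tabulate f)) ≡ countᶠ (p ∘ f)
length-filter-tabulate {n = zero}  f p = refl
length-filter-tabulate {n = suc n} f p with p (f zero)
... | true  = cong suc (length-filter-tabulate (f ∘ suc) p)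
... | false = length-filter-tabulate (f ∘ suc) p

delete-one : ∀ {A : Set} {x : A} (ys : List A) → x ∈ ys →
  Σ (List A) λ zs → suc (length zs) ≡ length ys × (∀ {z} → z ∈ ys → x ≢ z → z ∈ zs)
delete-one (y ∷ ys) (here refl) = ys , refl , λ { (here refl) x≢x → ⊥-elim (x≢x refl) ; (there p) _ → p }
delete-one (y ∷ ys) (there p) with delete-one ys p
... | zs , len , keep = y ∷ zs , cong suc len , λ { (here refl) _ → here refl ; (there q) ne → there (keep q ne) }

unique-length-≤ : ∀ {A : Set} (xs ys : List A) → Unique xs → All (_∈ ys) xs → length xs ≤ length ys
unique-length-≤ []       ys _                  _              = z≤n
unique-length-≤ (x ∷ xs) ys (x∉xs ∷ xs-unique) (x∈ys ∷ xs⊆ys) with delete-one ys x∈ys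
... | zs , len , keep =
  subst (suc (length xs) ≤_) len (s≤s (unique-length-≤ xs zs xs-unique xs⊆zs))
  where
  xs⊆zs : All (_∈ zs) xs
  xs⊆zs = All.zipWith (λ (x≢w , w∈ys) → keep w∈ys x≢w) (x∉xs , xs⊆ys)

-- An injective endomap of a finite set is surjective: a missed value would let f map
-- Fin (n + 1) injectively into n values, against the pigeonhole principle.
injective⇒surjective : ∀ {n} (f : Fin n → Fin n) → Injective _≡_ _≡_ f → ∀ y → ∃ λ x → f x ≡ y
injective⇒surjective {zero} f inj ()
injective⇒surjective {suc n} f inj y with any? (λ x → f x ≟ᶠ y)
... | yes hit = hit
... | no miss with pigeonhole (n<1+n n) (λ x → punchOut {i = y} {j = f x} (λ e → miss (x , sym e)))
... | i , j , i<j , eq =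
  ⊥-elim (<ᶠ⇒≢ i<j (inj (punchOut-injective {i = y} (λ e → miss (i , sym e)) (λ e → miss (j , sym e)) eq)))

allSubsets-unique : ∀ n → Unique (allSubsets n)
allSubsets-unique zero    = [] ∷ []
allSubsets-unique (suc n) =
  Unique.++⁺ (Unique.map⁺ (λ { refl → refl }) (allSubsets-unique n))
             (Unique.map⁺ (λ { refl → refl }) (allSubsets-unique n)) disjoint
  where
  disjoint : ∀ {v} → v ∈ map (true ∷_) (allSubsets n) × v ∈ map (false ∷_) (allSubsets n) → ⊥
  disjoint (p , q) with ∈-map⁻ (true ∷_) p | ∈-map⁻ (false ∷_) q
  ... | _ , _ , refl | _ , _ , ()

emptySet : ∀ {n} → Subset n
emptySet = tabulate (λ _ → false)

_⊆ᵇ_ : ∀ {n} → Subset n → Subset n → Set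
X ⊆ᵇ A = subsetᵇ X A ≡ true

⊆ᵇ-elim : ∀ {n} (X A : Subset n) → X ⊆ᵇ A → ∀ x → lookup X x ≡ true → lookup A x ≡ true
⊆ᵇ-elim X A X⊆A x x∈X with allᶠ-elim _ X⊆A x
... | r rewrite x∈X = r

Subsingleton : ∀ {n} → (Fin n → Bool) → Set
Subsingleton {n} B = ∀ (x y : Fin n) → B x ≡ true → B y ≡ true → x ≡ y

⊆-subsingleton : ∀ {n} (B : Fin n → Bool) → Subsingleton B → (S : Subset n) →
  (∀ y → lookup S y ≡ true → B y ≡ true) → S ≡ emptySet ⊎ S ≡ tabulate B
⊆-subsingleton B B-sub S S⊆B with anyᶠ (lookup S) in nonempty
... | false = inj₁ (subset-ext S _ (anyᶠ-false (lookup S) nonempty))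
... | true with anyᶠ-witness (lookup S) nonempty
... | y₀ , y₀∈S = inj₂ (subset-ext S B λ y →
        bool-ext (S⊆B y) (λ By → subst (λ z → lookup S z ≡ true) (B-sub y₀ y (S⊆B y₀ y₀∈S) By) y₀∈S))

module Traces {n : ℕ} (G : Graph n) where

  trace : Subset n → Subset n → Subset n
  trace = nbrUnion G

  lookup-trace : (A X : Subset n) (y : Fin n) →
    lookup (trace A X) y ≡ not (lookup A y) ∧ anyᶠ (λ x → lookup X x ∧ adj G x y)
  lookup-trace A X y = lookup∘tabulate _ y

  cutBoolCount-≤ : (A : Subset n) (Ts : List (Subset n)) →
    (∀ X → X ⊆ᵇ A → trace A X ∈ Ts) → cutBoolCount G A ≤ length Ts
  cutBoolCount-≤ A Ts covered =
    unique-length-≤ _ Ts (Unique.filter⁺ (T-dec ∘ realizable G A) (allSubsets-unique n)) (All.tabulate listed)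
    where
    listed : ∀ {S} → S ∈ filterᵇ (realizable G A) (allSubsets n) → S ∈ Ts
    listed {S} S∈
      with satisfied (any⁻ _ (allSubsets n) (proj₂ (∈-filter⁻ (T-dec ∘ realizable G A) {xs = allSubsets n} S∈)))
    ... | X , realizes with subsetᵇ X A in X⊆A | ≡-dec _≟ᵇ_ (trace A X) S
    ... | true  | yes refl = covered X X⊆A
    ... | true  | no _     = ⊥-elim realizes
    ... | false | _        = ⊥-elim realizes

  -- A side with at most one vertex has at most two traces: those of ∅ and of A.
  cutBoolCount-small-side : (A : Subset n) → Subsingleton (lookup A) → cutBoolCount G A ≤ 2
  cutBoolCount-small-side A A-sub = cutBoolCount-≤ A (trace A emptySet ∷ trace A A ∷ []) covered
    where
    covered : ∀ X → X ⊆ᵇ A → trace A X ∈ (trace A emptySet ∷ trace A A ∷ [])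
    covered X X⊆A with ⊆-subsingleton (lookup A) A-sub X (⊆ᵇ-elim X A X⊆A)
    ... | inj₁ refl = here refl
    ... | inj₂ X≡A  = there (here (cong (trace A) (trans X≡A (tabulate∘lookup A))))

  -- If the other side has at most one vertex, every trace is ∅ or all of Ā.
  cutBoolCount-small-coside : (A : Subset n) → Subsingleton (not ∘ lookup A) → cutBoolCount G A ≤ 2
  cutBoolCount-small-coside A Ā-sub = cutBoolCount-≤ A (emptySet ∷ tabulate (not ∘ lookup A) ∷ []) covered
    where
    covered : ∀ X → X ⊆ᵇ A → trace A X ∈ (emptySet ∷ tabulate (not ∘ lookup A) ∷ [])
    covered X _ with ⊆-subsingleton (not ∘ lookup A) Ā-sub (trace A X)
                       (λ y e → ∧-conicalˡ _ _ (trans (sym (lookup-trace A X y)) e))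
    ... | inj₁ e = here e
    ... | inj₂ e = there (here e)

-- Sets of at most k vertices are coded by k-tuples, of which there are n^k.

tuples : ∀ n → ℕ → List (List (Fin n))
tuples n zero    = [] ∷ []
tuples n (suc k) = concatMap (λ x → map (x ∷_) (tuples n k)) (allFin n)

length-concatMap-const : ∀ {A B : Set} (f : A → List B) ℓ xs →
  (∀ x → length (f x) ≡ ℓ) → length (concatMap f xs) ≡ length xs * ℓ
length-concatMap-const f ℓ []       h = refl
length-concatMap-const f ℓ (x ∷ xs) h =
  trans (length-++ (f x)) (cong₂ _+_ (h x) (length-concatMap-const f ℓ xs h))

length-tuples : ∀ n k → length (tuples n k) ≡ n ^ k
length-tuples n zero    = refl
length-tuples n (suc k) = begin
  length (tuples n (suc k))     ≡⟨ length-concatMap-const _ (n ^ k) (allFin n) length-branch ⟩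
  length (allFin n) * n ^ k     ≡⟨ cong (_* n ^ k) (length-tabulate {n = n} (λ i → i)) ⟩
  n * n ^ k                     ∎
  where
  open ≡-Reasoning
  length-branch : ∀ x → length (map (x ∷_) (tuples n k)) ≡ n ^ k
  length-branch x = trans (length-map (x ∷_) (tuples n k)) (length-tuples n k)

∈-tuples : ∀ n (t : List (Fin n)) → t ∈ tuples n (length t)
∈-tuples n []      = here refl
∈-tuples n (x ∷ t) =
  ∈-concatMap⁺ (λ y → map (y ∷_) (tuples n (length t))) (Any.map (λ { refl → ∈-map⁺ (x ∷_) (∈-tuples n t) }) (∈-allFin x))

module Coding {n : ℕ} (k : ℕ) (a b : Fin n) where
  open import Data.List.Membership.DecPropositional (_≟ᶠ_ {n}) using (_∈?_)

  occurs : Fin n → List (Fin n) → Bool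
  occurs y c = isYes (y ∈? c)

  code : (Fin n → Bool) → List (Fin n)
  code Q = filterᵇ Q (allFin n) ++ replicate (k ∸ countᶠ Q) a

  -- A k-tuple that is not the code of any set avoiding b (when a ≢ b).
  reserved : List (Fin n)
  reserved = b ∷ replicate (k ∸ 1) a

  length-code : (Q : Fin n → Bool) → countᶠ Q ≤ k → length (code Q) ≡ k
  length-code Q Q≤k = begin
    length (code Q)
      ≡⟨ length-++ (filterᵇ Q (allFin n)) ⟩
    length (filterᵇ Q (allFin n)) + length (replicate (k ∸ countᶠ Q) a)
      ≡⟨ cong₂ _+_ (length-filter-tabulate (λ i → i) Q) (length-replicate (k ∸ countᶠ Q)) ⟩
    countᶠ Q + (k ∸ countᶠ Q)
      ≡⟨ m+[n∸m]≡n Q≤k ⟩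
    k ∎
    where open ≡-Reasoning

  length-reserved : 1 ≤ k → length reserved ≡ k
  length-reserved 1≤k = trans (cong suc (length-replicate (k ∸ 1))) (m+[n∸m]≡n 1≤k)

  ∈-filter-elim : ∀ (Q : Fin n → Bool) {y} → y ∈ filterᵇ Q (allFin n) → Q y ≡ true
  ∈-filter-elim Q y∈ = T⇒≡true (proj₂ (∈-filter⁻ (T-dec ∘ Q) {xs = allFin n} y∈))

  occurs-sound : ∀ y c → occurs y c ≡ true → y ∈ c
  occurs-sound y c e = toWitness {a? = y ∈? c} (≡true⇒T e)

  occurs-complete : ∀ y c → y ∈ c → occurs y c ≡ true
  occurs-complete y c y∈c = T⇒≡true (fromWitness {a? = y ∈? c} y∈c)

  occurs-code : (Q : Fin n → Bool) (y : Fin n) → y ≢ a → occurs y (code Q) ≡ Q y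
  occurs-code Q y y≢a = bool-ext only-Q all-Q
    where
    only-Q : occurs y (code Q) ≡ true → Q y ≡ true
    only-Q e with ∈-++⁻ (filterᵇ Q (allFin n)) (occurs-sound y (code Q) e)
    ... | inj₁ y∈Q   = ∈-filter-elim Q y∈Q
    ... | inj₂ y∈pad = ⊥-elim (y≢a (All.lookup (replicate⁺ {P = _≡ a} (k ∸ countᶠ Q) refl) y∈pad))
    all-Q : Q y ≡ true → occurs y (code Q) ≡ true
    all-Q Qy = occurs-complete y (code Q) (∈-++⁺ˡ (∈-filter⁺ (T-dec ∘ Q) (∈-allFin y) (≡true⇒T Qy)))

  code≢reserved : (Q : Fin n → Bool) → Q b ≡ false → a ≢ b → code Q ≢ reserved
  code≢reserved Q Qb a≢b = differs (filterᵇ Q (allFin n)) (λ _ → ∈-filter-elim Q) (k ∸ countᶠ Q) _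
    where
    -- the first entry of a code is an element of Q or a, hence not b
    differs : ∀ l → (∀ z → z ∈ l → Q z ≡ true) → ∀ r rest → l ++ replicate r a ≢ b ∷ rest
    differs (z ∷ l) l⊆Q r       rest refl = true≢false (trans (sym (l⊆Q z (here refl))) Qb)
    differs []      l⊆Q (suc r) rest refl = a≢b refl

-- Let F turn a vertex predicate into a set, ignoring the
-- value at a.
cutBoolCount-by-tuples : ∀ {n} (G : Graph n) (A : Subset n) (k : ℕ) → 1 ≤ k →
  (a b : Fin n) → a ≢ b →
  (F : (Fin n → Bool) → Subset n) → (∀ Q Q′ → (∀ y → y ≢ a → Q y ≡ Q′ y) → F Q ≡ F Q′) →
  (S₀ : Subset n) →
  (∀ X → X ⊆ᵇ A → nbrUnion G A X ≡ S₀ ⊎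
     Σ (Fin n → Bool) λ Q → countᶠ Q ≤ k × Q b ≡ false × F Q ≡ nbrUnion G A X) →
  cutBoolCount G A ≤ n ^ k
cutBoolCount-by-tuples {n} G A k 1≤k a b a≢b F F-local S₀ traces =
  subst (cutBoolCount G A ≤_) (trans (length-map decode (tuples n k)) (length-tuples n k))
        (cutBoolCount-≤ A (map decode (tuples n k)) covered)
  where
  open Traces G
  open Coding k a b

  decode : List (Fin n) → Subset n
  decode c = if does (≡-decᴸ _≟ᶠ_ c reserved) then S₀ else F (λ y → occurs y c)

  decoded : ∀ c → length c ≡ k → decode c ∈ map decode (tuples n k)
  decoded c refl = ∈-map⁺ decode (∈-tuples n c)

  decode-reserved : ∀ c → c ≡ reserved → decode c ≡ S₀
  decode-reserved c c≡r with ≡-decᴸ _≟ᶠ_ c reserved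
  ... | yes _   = refl
  ... | no c≢r = ⊥-elim (c≢r c≡r)

  decode-code : ∀ Q → Q b ≡ false → decode (code Q) ≡ F Q
  decode-code Q Qb with ≡-decᴸ _≟ᶠ_ (code Q) reserved
  ... | yes c≡r = ⊥-elim (code≢reserved Q Qb a≢b c≡r)
  ... | no _    = F-local _ Q (occurs-code Q)

  covered : ∀ X → X ⊆ᵇ A → trace A X ∈ map decode (tuples n k)
  covered X X⊆A with traces X X⊆A
  ... | inj₁ tr≡S₀ =
    subst (_∈ _) (trans (decode-reserved reserved refl) (sym tr≡S₀)) (decoded reserved (length-reserved 1≤k))
  ... | inj₂ (Q , Q≤k , Qb , FQ≡tr) =
    subst (_∈ _) (trans (decode-code Q Qb) FQ≡tr) (decoded (code Q) (length-code Q Q≤k))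

module OrderedCuts {n : ℕ} (G : Graph n) (pos : Fin n → Fin n) (k : ℕ)
  (degenerate : ∀ v → laterNbrs (complement G) pos v ≤ k) where

  open Traces G

  few-later-non-neighbours : ∀ v (Q : Fin n → Bool) →
    (∀ u → Q u ≡ true → v ≢ u × adj G v u ≡ false × toℕ (pos v) < toℕ (pos u)) → countᶠ Q ≤ k
  few-later-non-neighbours v Q Q-later = ≤-trans (countᶠ-mono Q _ later) (degenerate v)
    where
    later : ∀ u → Q u ≡ true → adj (complement G) v u ∧ does (pos v <ᶠ? pos u) ≡ true
    later u Qu with Q-later u Qu
    ... | v≢u , non-adj , v<u with v ≟ᶠ u
    ...   | yes v≡u = ⊥-elim (v≢u v≡u)
    ...   | no _ rewrite non-adj = T⇒≡true (<⇒<ᵇ v<u)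

  outsideMinus : Subset n → (Fin n → Bool) → Subset n
  outsideMinus A Q = tabulate (λ y → not (lookup A y) ∧ not (Q y))

  -- If A precedes Ā and x₀ ∈ X ⊆ A, the vertices of Ā with no neighbour in X are later
  -- non-neighbours of x₀; so the trace of X is Ā minus a set of at most k vertices.
  nonempty-trace : (A X : Subset n) → X ⊆ᵇ A →
    (∀ x y → lookup A x ≡ true → lookup A y ≡ false → toℕ (pos x) < toℕ (pos y)) →
    (x₀ : Fin n) → lookup X x₀ ≡ true → (b : Fin n) → lookup A b ≡ true →
    Σ (Fin n → Bool) λ Q → countᶠ Q ≤ k × Q b ≡ false × outsideMinus A Q ≡ trace A X
  nonempty-trace A X X⊆A A-first x₀ x₀∈X b b∈A =
    missed , few-later-non-neighbours x₀ missed missed-later , missed-b , tabulate-cong complement-missed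
    where
    hit : Fin n → Bool
    hit y = anyᶠ (λ x → lookup X x ∧ adj G x y)

    missed : Fin n → Bool
    missed y = not (lookup A y) ∧ not (hit y)

    x₀∈A : lookup A x₀ ≡ true
    x₀∈A = ⊆ᵇ-elim X A X⊆A x₀ x₀∈X

    missed-b : missed b ≡ false
    missed-b rewrite b∈A = refl

    missed-later : ∀ y → missed y ≡ true → x₀ ≢ y × adj G x₀ y ≡ false × toℕ (pos x₀) < toℕ (pos y)
    missed-later y my with lookup A y in y∈A | hit y in hit-y
    ... | false | false = (λ { refl → true≢false (trans (sym x₀∈A) y∈A) })
                        , subst (λ b → b ∧ adj G x₀ y ≡ false) x₀∈X (anyᶠ-false _ hit-y x₀)
                        , A-first x₀ y x₀∈A y∈A

    complement-missed : ∀ y → not (lookup A y) ∧ not (missed y) ≡ not (lookup A y) ∧ hit y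
    complement-missed y with lookup A y
    ... | true  = refl
    ... | false = not-involutive (hit y)

  -- If A precedes Ā and contains two vertices a ≢ b, the cut has at most n^k traces:
  -- nonempty sets X give the traces above, and X = ∅ gives the trace ∅.
  cutBoolCount-initial : (A : Subset n) (a b : Fin n) → a ≢ b →
    lookup A a ≡ true → lookup A b ≡ true → 1 ≤ k →
    (∀ x y → lookup A x ≡ true → lookup A y ≡ false → toℕ (pos x) < toℕ (pos y)) →
    cutBoolCount G A ≤ n ^ k
  cutBoolCount-initial A a b a≢b a∈A b∈A 1≤k A-first =
    cutBoolCount-by-tuples G A k 1≤k a b a≢b (outsideMinus A) local (trace A emptySet) traces
    where
    local : ∀ Q Q′ → (∀ y → y ≢ a → Q y ≡ Q′ y) → outsideMinus A Q ≡ outsideMinus A Q′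
    local Q Q′ Q≈Q′ = tabulate-cong same
      where
      same : ∀ y → not (lookup A y) ∧ not (Q y) ≡ not (lookup A y) ∧ not (Q′ y)
      same y with lookup A y in y∈A
      ... | true  = refl
      ... | false = cong not (Q≈Q′ y λ { refl → true≢false (trans (sym a∈A) y∈A) })

    traces : ∀ X → X ⊆ᵇ A → trace A X ≡ trace A emptySet ⊎
      Σ (Fin n → Bool) λ Q → countᶠ Q ≤ k × Q b ≡ false × outsideMinus A Q ≡ trace A X
    traces X X⊆A with anyᶠ (lookup X) in nonempty
    ... | false = inj₁ (cong (trace A) (subset-ext X _ (anyᶠ-false (lookup X) nonempty)))
    ... | true with anyᶠ-witness (lookup X) nonempty
    ...   | x₀ , x₀∈X = inj₂ (nonempty-trace A X X⊆A A-first x₀ x₀∈X b b∈A)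

  -- If A follows Ā and |X| > k for X ⊆ A, then X dominates Ā: a vertex y ∈ Ā not adjacent
  -- to X would have all of X among its at most k later non-neighbours.
  large-trace : (A X : Subset n) → X ⊆ᵇ A → k < countᶠ (lookup X) →
    (∀ x y → lookup A x ≡ true → lookup A y ≡ false → toℕ (pos y) < toℕ (pos x)) →
    trace A X ≡ trace A A
  large-trace A X X⊆A X>k A-last = tabulate-cong same
    where
    same : ∀ y → not (lookup A y) ∧ anyᶠ (λ x → lookup X x ∧ adj G x y)
               ≡ not (lookup A y) ∧ anyᶠ (λ x → lookup A x ∧ adj G x y)
    same y with lookup A y in y∈A
    ... | true  = refl
    ... | false = bool-ext widen narrow
      where
      widen : anyᶠ (λ x → lookup X x ∧ adj G x y) ≡ true → anyᶠ (λ x → lookup A x ∧ adj G x y) ≡ true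
      widen hitX with anyᶠ-witness _ hitX
      ... | x , x∈X∧xy = anyᶠ-intro _ x
            (subst (λ b → b ∧ adj G x y ≡ true) (sym (⊆ᵇ-elim X A X⊆A x (∧-conicalˡ _ _ x∈X∧xy)))
                   (∧-conicalʳ _ _ x∈X∧xy))
      narrow : anyᶠ (λ x → lookup A x ∧ adj G x y) ≡ true → anyᶠ (λ x → lookup X x ∧ adj G x y) ≡ true
      narrow _ with anyᶠ (λ x → lookup X x ∧ adj G x y) in hitX
      ... | true  = refl
      ... | false = ⊥-elim (<⇒≱ X>k (few-later-non-neighbours y (lookup X) X-later))
        where
        X-later : ∀ x → lookup X x ≡ true → y ≢ x × adj G y x ≡ false × toℕ (pos y) < toℕ (pos x)
        X-later x x∈X = (λ { refl → true≢false (trans (sym x∈A) y∈A) })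
                      , trans (adj-sym G y x) (subst (λ b → b ∧ adj G x y ≡ false) x∈X (anyᶠ-false _ hitX x))
                      , A-last x y x∈A y∈A
          where
          x∈A : lookup A x ≡ true
          x∈A = ⊆ᵇ-elim X A X⊆A x x∈X

  -- If A follows Ā and Ā contains two vertices a ≢ b, the cut has at most n^k traces:
  -- a set X ⊆ A with |X| ≤ k is coded by a k-tuple, and larger X all have the trace of A.
  cutBoolCount-final : (A : Subset n) (a b : Fin n) → a ≢ b →
    lookup A a ≡ false → lookup A b ≡ false → 1 ≤ k →
    (∀ x y → lookup A x ≡ true → lookup A y ≡ false → toℕ (pos y) < toℕ (pos x)) →
    cutBoolCount G A ≤ n ^ k
  cutBoolCount-final A a b a≢b a∉A b∉A 1≤k A-last =
    cutBoolCount-by-tuples G A k 1≤k a b a≢b insideTrace local (trace A A) traces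
    where
    inside : (Fin n → Bool) → Subset n
    inside Q = tabulate (λ x → lookup A x ∧ Q x)

    insideTrace : (Fin n → Bool) → Subset n
    insideTrace Q = trace A (inside Q)

    local : ∀ Q Q′ → (∀ y → y ≢ a → Q y ≡ Q′ y) → insideTrace Q ≡ insideTrace Q′
    local Q Q′ Q≈Q′ = cong (trace A) (tabulate-cong same)
      where
      same : ∀ x → lookup A x ∧ Q x ≡ lookup A x ∧ Q′ x
      same x with lookup A x in x∈A
      ... | false = refl
      ... | true  = Q≈Q′ x λ { refl → true≢false (trans (sym x∈A) a∉A) }

    traces : ∀ X → X ⊆ᵇ A → trace A X ≡ trace A A ⊎
      Σ (Fin n → Bool) λ Q → countᶠ Q ≤ k × Q b ≡ false × insideTrace Q ≡ trace A X
    traces X X⊆A with countᶠ (lookup X) ≤? k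
    ... | no X≰k  = inj₁ (large-trace A X X⊆A (≰⇒> X≰k) A-last)
    ... | yes X≤k = inj₂ (lookup X , X≤k , X-b , cong (trace A) (sym (subset-ext X _ X-inside)))
      where
      X-b : lookup X b ≡ false
      X-b with lookup X b in b∈X
      ... | true  = ⊥-elim (true≢false (trans (sym (⊆ᵇ-elim X A X⊆A b b∈X)) b∉A))
      ... | false = refl
      X-inside : ∀ x → lookup X x ≡ lookup A x ∧ lookup X x
      X-inside x with lookup A x in x∈A
      ... | true  = refl
      ... | false with lookup X x in x∈X
      ...   | false = refl
      ...   | true  = ⊥-elim (true≢false (trans (sym (⊆ᵇ-elim X A X⊆A x x∈X)) x∈A))

-- The two sides of a tree edge uv are the colour classes of a colouring that changes only across uv.

agrees : Bool → Bool → Bool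
agrees s b = if s then b else not b

agrees-intro : ∀ {s b} → b ≡ s → agrees s b ≡ true
agrees-intro {true}  refl = refl
agrees-intro {false} refl = refl

agrees-elim : ∀ s b → agrees s b ≡ true → b ≡ s
agrees-elim true  true  _ = refl
agrees-elim false false _ = refl

module Walks {m : ℕ} (Tr : SGraph m) where

  reach-trans : ∀ {a b c} → Reach Tr a b → Reach Tr b c → Reach Tr a c
  reach-trans here         r′ = r′
  reach-trans (step ab r) r′ = step ab (reach-trans r r′)

  reach-sym : ∀ {a b} → Reach Tr a b → Reach Tr b a
  reach-sym here                    = here
  reach-sym (step {a} {b} ab r) = reach-trans (reach-sym r) (step (trans (tsym Tr b a) ab) here)

  sameEdge? : (a b u v : Fin m) → Dec (SameEdge a b u v)
  sameEdge? a b u v = ((a ≟ᶠ u) ×-dec (b ≟ᶠ v)) ⊎-dec ((a ≟ᶠ v) ×-dec (b ≟ᶠ u))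

  -- Cutting a walk at its last traversal of the edge uv: what remains is a walk avoiding uv,
  -- starting at the beginning of the walk, at u, or at v.
  last-traversal : ∀ {u v a c} → Reach Tr a c →
    ReachAvoid Tr u v a c ⊎ ReachAvoid Tr u v u c ⊎ ReachAvoid Tr u v v c
  last-traversal here = inj₁ here
  last-traversal {u} {v} (step {a} {b} ab r) with last-traversal {u} {v} r
  ... | inj₂ later = inj₂ later
  ... | inj₁ avoid with sameEdge? a b u v
  ...   | yes (inj₁ (refl , refl)) = inj₂ (inj₂ avoid)
  ...   | yes (inj₂ (refl , refl)) = inj₂ (inj₁ avoid)
  ...   | no  other                = inj₁ (step ab other avoid)

  record Separation (u v : Fin m) : Set where
    field
      colour    : Fin m → Bool
      constant  : ∀ a b → tadj Tr a b ≡ true → ¬ SameEdge a b u v → colour a ≡ colour b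
      separates : colour u ≢ colour v

  module _ {u v : Fin m} (S : Separation u v) where
    open Separation S

    colour-avoiding : ∀ {a c} → ReachAvoid Tr u v a c → colour a ≡ colour c
    colour-avoiding here                    = refl
    colour-avoiding (step {a} {b} ab ne r) = trans (constant a b ab ne) (colour-avoiding r)

    bridge : ¬ ReachAvoid Tr u v u v
    bridge r = separates (colour-avoiding r)

    side-of-u : (∀ a b → Reach Tr a b) → ∀ w → colour w ≡ colour u → ReachAvoid Tr u v u w
    side-of-u connected w same with last-traversal (connected u w)
    ... | inj₁ r        = r
    ... | inj₂ (inj₁ r) = r
    ... | inj₂ (inj₂ r) = ⊥-elim (separates (trans (sym same) (sym (colour-avoiding r))))

    cut-by-colour : (∀ a b → Reach Tr a b) → ∀ {n} (δ : Fin n → Fin m) (A : Subset n) →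
      (∀ x → (lookup A x ≡ true → ReachAvoid Tr u v u (δ x)) × (ReachAvoid Tr u v u (δ x) → lookup A x ≡ true)) →
      ∀ x → lookup A x ≡ agrees (colour u) (colour (δ x))
    cut-by-colour connected δ A is-cut x = bool-ext
      (λ x∈A → agrees-intro (sym (colour-avoiding (proj₁ (is-cut x) x∈A))))
      (λ same → proj₂ (is-cut x) (side-of-u connected (δ x) (agrees-elim (colour u) (colour (δ x)) same)))

≡ᵇ⇒≡′ : ∀ {m n} → (m ≡ᵇ n) ≡ true → m ≡ n
≡ᵇ⇒≡′ {m} {n} e = ≡ᵇ⇒≡ m n (≡true⇒T e)

≡ᵇ-refl : ∀ m → (m ≡ᵇ m) ≡ true
≡ᵇ-refl m = T⇒≡true (≡⇒≡ᵇ m m refl)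

≡ᵇ-false : ∀ {m n} → m ≢ n → (m ≡ᵇ n) ≡ false
≡ᵇ-false {m} {n} m≢n with m ≡ᵇ n in e
... | true  = ⊥-elim (m≢n (≡ᵇ⇒≡′ e))
... | false = refl

≡ᵇ-sym : ∀ m n → (m ≡ᵇ n) ≡ (n ≡ᵇ m)
≡ᵇ-sym zero    zero    = refl
≡ᵇ-sym zero    (suc n) = refl
≡ᵇ-sym (suc m) zero    = refl
≡ᵇ-sym (suc m) (suc n) = ≡ᵇ-sym m n

≡ᵇ-disjoint : ∀ {a b} → a ≢ b → ∀ t → (t ≡ᵇ a) ∧ (t ≡ᵇ b) ≡ false
≡ᵇ-disjoint {a} {b} a≢b t with t ≡ᵇ a in t≡a
... | false = refl
... | true  = ≡ᵇ-false {t} {b} (λ t≡b → a≢b (trans (sym (≡ᵇ⇒≡′ t≡a)) t≡b))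

<ᵇ⇒<′ : ∀ {m n} → (m <ᵇ n) ≡ true → m < n
<ᵇ⇒<′ {m} {n} e = <ᵇ⇒< m n (≡true⇒T e)

<⇒<ᵇ′ : ∀ {m n} → m < n → (m <ᵇ n) ≡ true
<⇒<ᵇ′ m<n = T⇒≡true (<⇒<ᵇ m<n)

<ᵇ-false⇒≥ : ∀ {m n} → (m <ᵇ n) ≡ false → n ≤ m
<ᵇ-false⇒≥ e = ≮⇒≥ λ m<n → true≢false (trans (sym (<⇒<ᵇ′ m<n)) e)

<ᵇ-false : ∀ {m n} → n ≤ m → (m <ᵇ n) ≡ false
<ᵇ-false {m} {n} n≤m with m <ᵇ n in m<n
... | true  = ⊥-elim (<⇒≱ (<ᵇ⇒<′ m<n) n≤m)
... | false = refl

<ᵇ-irrefl : ∀ m → (m <ᵇ m) ≡ false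
<ᵇ-irrefl zero    = refl
<ᵇ-irrefl (suc m) = <ᵇ-irrefl m

<ᵇ-suc : ∀ {i n} → n ≢ i → (i <ᵇ suc n) ≡ (i <ᵇ n)
<ᵇ-suc {zero}  {zero}  n≢i = ⊥-elim (n≢i refl)
<ᵇ-suc {zero}  {suc n} _   = refl
<ᵇ-suc {suc i} {zero}  _   = refl
<ᵇ-suc {suc i} {suc n} n≢i = <ᵇ-suc {i} {n} (n≢i ∘ cong suc)

countBelow : ℕ → (ℕ → Bool) → ℕ
countBelow K P = countᶠ {K} (P ∘ toℕ)

countBelow-cong : ∀ K (P Q : ℕ → Bool) → (∀ t → t < K → P t ≡ Q t) → countBelow K P ≡ countBelow K Q
countBelow-cong zero    P Q P≈Q = refl
countBelow-cong (suc K) P Q P≈Q rewrite P≈Q 0 z<s with Q 0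
... | true  = cong suc (countBelow-cong K (P ∘ suc) (Q ∘ suc) (λ t t<K → P≈Q (suc t) (s<s t<K)))
... | false = countBelow-cong K (P ∘ suc) (Q ∘ suc) (λ t t<K → P≈Q (suc t) (s<s t<K))

countBelow-none : ∀ K → countBelow K (λ _ → false) ≡ 0
countBelow-none zero    = refl
countBelow-none (suc K) = countBelow-none K

countBelow-≡ᵇ-< : ∀ K c → c < K → countBelow K (_≡ᵇ c) ≡ 1
countBelow-≡ᵇ-< (suc K) zero    _         = cong suc (countBelow-none K)
countBelow-≡ᵇ-< (suc K) (suc c) (s<s c<K) = countBelow-≡ᵇ-< K c c<K

countBelow-≡ᵇ-≥ : ∀ K c → K ≤ c → countBelow K (_≡ᵇ c) ≡ 0
countBelow-≡ᵇ-≥ zero    c       _         = refl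
countBelow-≡ᵇ-≥ (suc K) (suc c) (s≤s K≤c) = countBelow-≡ᵇ-≥ K c K≤c

countBelow-∨ : ∀ K (P Q : ℕ → Bool) → (∀ t → P t ∧ Q t ≡ false) →
  countBelow K (λ t → P t ∨ Q t) ≡ countBelow K P + countBelow K Q
countBelow-∨ zero    P Q disjoint = refl
countBelow-∨ (suc K) P Q disjoint with P 0 in P0 | Q 0 in Q0
... | true  | true  = ⊥-elim (true≢false (trans (sym (cong₂ _∧_ P0 Q0)) (disjoint 0)))
... | true  | false = cong suc (countBelow-∨ K (P ∘ suc) (Q ∘ suc) (disjoint ∘ suc))
... | false | true  = trans (cong suc (countBelow-∨ K (P ∘ suc) (Q ∘ suc) (disjoint ∘ suc))) (sym (+-suc _ _))
... | false | false = countBelow-∨ K (P ∘ suc) (Q ∘ suc) (disjoint ∘ suc)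

countᶠ-cong : ∀ {K} (f g : Fin K → Bool) → (∀ x → f x ≡ g x) → countᶠ f ≡ countᶠ g
countᶠ-cong f g f≈g = cong ∣_∣ (tabulate-cong f≈g)

countᶠ-+ : ∀ K L (f : Fin (K + L) → Bool) → countᶠ f ≡ countᶠ (f ∘ (_↑ˡ L)) + countᶠ (f ∘ (K ↑ʳ_))
countᶠ-+ zero    L f = refl
countᶠ-+ (suc K) L f with f zero
... | true  = cong suc (countᶠ-+ K L (f ∘ suc))
... | false = countᶠ-+ K L (f ∘ suc)

-- For K = N + 1 the caterpillar has legs ℓ₀ … ℓ_N and spine nodes s₀ … s_N.  The spine is
-- the path s₀ – s₁ – … – s_N; the legs ℓ₀ and ℓ₁ hang at s₀ and ℓ_{j+1} hangs at s_j.  Its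
-- leaves are ℓ₀, …, ℓ_N, s_N, in this order, and s₀, …, s_{N−1} have degree three.

legAdj : ℕ → ℕ → Bool
legAdj i j = ((i ≡ᵇ 0) ∧ (j ≡ᵇ 0)) ∨ (i ≡ᵇ suc j)

spineAdj : ℕ → ℕ → Bool
spineAdj i j = (i ≡ᵇ suc j) ∨ (j ≡ᵇ suc i)

legAdj-cases : ∀ i j → legAdj i j ≡ true → (i ≡ 0 × j ≡ 0) ⊎ i ≡ suc j
legAdj-cases zero    zero _ = inj₁ (refl , refl)
legAdj-cases (suc i) j    e = inj₂ (≡ᵇ⇒≡′ e)

legAdj-functional : ∀ i j j′ → legAdj i j ≡ true → legAdj i j′ ≡ true → j ≡ j′
legAdj-functional i j j′ e e′ with legAdj-cases i j e | legAdj-cases i j′ e′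
... | inj₁ (_ , refl) | inj₁ (_ , refl) = refl
... | inj₁ (refl , _) | inj₂ ()
... | inj₂ ()         | inj₁ (refl , _)
... | inj₂ refl       | inj₂ i≡j′+1     = suc-injective i≡j′+1

module Caterpillar (N : ℕ) where

  K M : ℕ
  K = suc N
  M = K + K

  -- Legs are inj₁ and spine nodes inj₂.
  Node : Set
  Node = Fin K ⊎ Fin K

  node : Fin M → Node
  node = splitAt K

  node-injective : ∀ {a b} → node a ≡ node b → a ≡ b
  node-injective {a} {b} e = trans (sym (join-splitAt K K a)) (trans (cong (join K K) e) (join-splitAt K K b))

  leg spine : Fin K → Fin M
  leg i   = i ↑ˡ K
  spine i = K ↑ʳ i

  node-leg : ∀ i → node (leg i) ≡ inj₁ i
  node-leg i = splitAt-↑ˡ K i K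

  node-spine : ∀ i → node (spine i) ≡ inj₂ i
  node-spine i = splitAt-↑ʳ K K i

  nodeAdj : Node → Node → Bool
  nodeAdj (inj₁ i) (inj₁ j) = false
  nodeAdj (inj₁ i) (inj₂ j) = legAdj (toℕ i) (toℕ j)
  nodeAdj (inj₂ i) (inj₁ j) = legAdj (toℕ j) (toℕ i)
  nodeAdj (inj₂ i) (inj₂ j) = spineAdj (toℕ i) (toℕ j)

  nodeAdj-sym : ∀ p q → nodeAdj p q ≡ nodeAdj q p
  nodeAdj-sym (inj₁ i) (inj₁ j) = refl
  nodeAdj-sym (inj₁ i) (inj₂ j) = refl
  nodeAdj-sym (inj₂ i) (inj₁ j) = refl
  nodeAdj-sym (inj₂ i) (inj₂ j) = ∨-comm (toℕ i ≡ᵇ suc (toℕ j)) (toℕ j ≡ᵇ suc (toℕ i))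

  nodeAdj-irrefl : ∀ p → nodeAdj p p ≡ false
  nodeAdj-irrefl (inj₁ i) = refl
  nodeAdj-irrefl (inj₂ i) rewrite ≡ᵇ-false (1+n≢n ∘ sym {x = toℕ i}) = refl

  caterpillar : SGraph M
  caterpillar = record
    { tadj    = λ a b → nodeAdj (node a) (node b)
    ; tsym    = λ a b → nodeAdj-sym (node a) (node b)
    ; tirrefl = λ a → nodeAdj-irrefl (node a) }

  open Walks caterpillar

  -- Connectivity: every node is joined to ℓ₀, descending along the spine.
  root : Fin M
  root = leg zero

  predecessor : ∀ {t} (i : Fin K) → toℕ i ≡ suc t → Σ (Fin K) λ i′ → toℕ i′ ≡ t
  predecessor i i≡t+1 = fromℕ< (<⇒≤ (subst (_< K) i≡t+1 (toℕ<n i))) , toℕ-fromℕ< _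

  spine-to-root : ∀ t (i : Fin K) → toℕ i ≡ t → Reach caterpillar (spine i) root
  spine-to-root zero i i≡0 = step s₀ℓ₀ here
    where
    s₀ℓ₀ : tadj caterpillar (spine i) root ≡ true
    s₀ℓ₀ rewrite node-spine i | node-leg (zero {N}) | i≡0 = refl
  spine-to-root (suc t) i i≡t+1 with predecessor i i≡t+1
  ... | i′ , i′≡t = step sᵢsᵢ′ (spine-to-root t i′ i′≡t)
    where
    sᵢsᵢ′ : tadj caterpillar (spine i) (spine i′) ≡ true
    sᵢsᵢ′ rewrite node-spine i | node-spine i′ | i≡t+1 | i′≡t | ≡ᵇ-refl t = refl

  leg-to-root : ∀ t (i : Fin K) → toℕ i ≡ t → Reach caterpillar (leg i) root
  leg-to-root zero i i≡0 with toℕ-injective {i = i} {j = zero} i≡0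
  ... | refl = here
  leg-to-root (suc t) i i≡t+1 with predecessor i i≡t+1
  ... | i′ , i′≡t = step ℓᵢsᵢ′ (spine-to-root t i′ i′≡t)
    where
    ℓᵢsᵢ′ : tadj caterpillar (leg i) (spine i′) ≡ true
    ℓᵢsᵢ′ rewrite node-leg i | node-spine i′ | i≡t+1 | i′≡t | ≡ᵇ-refl t = refl

  connected : ∀ a b → Reach caterpillar a b
  connected a b = reach-trans (to-root a) (reach-sym (to-root b))
    where
    to-root : ∀ a → Reach caterpillar a root
    to-root a with node a in node-a
    ... | inj₁ i = subst (λ c → Reach caterpillar c root) (node-injective (trans (node-leg i) (sym node-a))) (leg-to-root _ i refl)
    ... | inj₂ i = subst (λ c → Reach caterpillar c root) (node-injective (trans (node-spine i) (sym node-a))) (spine-to-root _ i refl)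

  legNbr : Node → ℕ → Bool
  legNbr (inj₁ i) t = false
  legNbr (inj₂ j) t = legAdj t (toℕ j)

  spineNbr : Node → ℕ → Bool
  spineNbr (inj₁ i) t = legAdj (toℕ i) t
  spineNbr (inj₂ j) t = spineAdj (toℕ j) t

  nodeDegree : Node → ℕ
  nodeDegree p = countBelow K (legNbr p) + countBelow K (spineNbr p)

  tdeg-node : ∀ a → tdeg caterpillar a ≡ nodeDegree (node a)
  tdeg-node a = trans (countᶠ-+ K K (λ b → nodeAdj (node a) (node b)))
    (cong₂ _+_ (countᶠ-cong _ _ (λ i → trans (cong (nodeAdj (node a)) (node-leg i)) (toLeg (node a) i)))
               (countᶠ-cong _ _ (λ i → trans (cong (nodeAdj (node a)) (node-spine i)) (toSpine (node a) i))))
    where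
    toLeg : ∀ p i → nodeAdj p (inj₁ i) ≡ legNbr p (toℕ i)
    toLeg (inj₁ _) i = refl
    toLeg (inj₂ _) i = refl
    toSpine : ∀ p i → nodeAdj p (inj₂ i) ≡ spineNbr p (toℕ i)
    toSpine (inj₁ _) i = refl
    toSpine (inj₂ _) i = refl

  leg-degree : ∀ i → nodeDegree (inj₁ i) ≡ 1
  leg-degree i = trans (cong (_+ countBelow K (legAdj (toℕ i))) (countBelow-none K)) (hangs (toℕ i) (toℕ<n i))
    where
    hangs : ∀ x → x < K → countBelow K (legAdj x) ≡ 1
    hangs zero    0<K   = trans (countBelow-cong K _ (_≡ᵇ 0) (λ t _ → ∨-identityʳ (t ≡ᵇ 0))) (countBelow-≡ᵇ-< K 0 0<K)
    hangs (suc x) x+1<K = trans (countBelow-cong K _ (_≡ᵇ x) (λ t _ → ≡ᵇ-sym x t)) (countBelow-≡ᵇ-< K x (<-trans (n<1+n x) x+1<K))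

  -- Counting the neighbours ℓ_{j+1} and s_{j+1} of s_j that exist only when j < N.
  spine-degree : ∀ j → nodeDegree (inj₂ j) ≡ suc (countBelow K (_≡ᵇ suc (toℕ j)) + countBelow K (_≡ᵇ suc (toℕ j)))
  spine-degree j = by-index (toℕ j) (toℕ<n j)
    where
    next : ℕ → ℕ
    next x = countBelow K (_≡ᵇ suc x)
    by-index : ∀ x → x < K → countBelow K (λ t → legAdj t x) + countBelow K (spineAdj x) ≡ suc (next x + next x)
    by-index zero 0<K = cong (_+ next 0) legs
      where
      -- ℓ₀ and ℓ₁ hang at s₀
      legs : countBelow K (λ t → legAdj t 0) ≡ suc (next 0)
      legs = begin
        countBelow K (λ t → legAdj t 0)
          ≡⟨ countBelow-cong K _ _ (λ t _ → cong (_∨ (t ≡ᵇ 1)) (∧-identityʳ (t ≡ᵇ 0))) ⟩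
        countBelow K (λ t → (t ≡ᵇ 0) ∨ (t ≡ᵇ 1))
          ≡⟨ countBelow-∨ K (_≡ᵇ 0) (_≡ᵇ 1) (≡ᵇ-disjoint 0≢1+n) ⟩
        countBelow K (_≡ᵇ 0) + next 0
          ≡⟨ cong (_+ next 0) (countBelow-≡ᵇ-< K 0 0<K) ⟩
        suc (next 0)
          ∎
        where open ≡-Reasoning
    by-index (suc x) x+1<K = trans (cong₂ _+_ legs spines) (+-suc _ _)
      where
      -- only ℓ_{x+2} hangs at s_{x+1}
      legs : countBelow K (λ t → legAdj t (suc x)) ≡ next (suc x)
      legs = countBelow-cong K _ _ (λ t _ → cong (_∨ (t ≡ᵇ suc (suc x))) (∧-zeroʳ (t ≡ᵇ 0)))
      -- s_x is the spine neighbour before s_{x+1}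
      spines : countBelow K (spineAdj (suc x)) ≡ suc (next (suc x))
      spines = begin
        countBelow K (spineAdj (suc x))
          ≡⟨ countBelow-cong K _ _ (λ t _ → cong (_∨ (t ≡ᵇ suc (suc x))) (≡ᵇ-sym x t)) ⟩
        countBelow K (λ t → (t ≡ᵇ x) ∨ (t ≡ᵇ suc (suc x)))
          ≡⟨ countBelow-∨ K (_≡ᵇ x) (_≡ᵇ suc (suc x)) (≡ᵇ-disjoint (<⇒≢ (<-trans (n<1+n x) (n<1+n (suc x))))) ⟩
        countBelow K (_≡ᵇ x) + next (suc x)
          ≡⟨ cong (_+ next (suc x)) (countBelow-≡ᵇ-< K x (<-trans (n<1+n x) x+1<K)) ⟩
        suc (next (suc x))
          ∎
        where open ≡-Reasoning

  internal-degree : ∀ j → suc (toℕ j) < K → nodeDegree (inj₂ j) ≡ 3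
  internal-degree j j+1<K = trans (spine-degree j) (cong (λ c → suc (c + c)) (countBelow-≡ᵇ-< K _ j+1<K))

  last-spine-degree : nodeDegree (inj₂ (fromℕ N)) ≡ 1
  last-spine-degree = trans (spine-degree (fromℕ N))
    (cong (λ c → suc (c + c)) (countBelow-≡ᵇ-≥ K _ (≤-reflexive (cong suc (sym (toℕ-fromℕ N))))))

  leaf : Fin (suc K) → Fin M
  leaf p with toℕ p <? K
  ... | yes p<K = leg (fromℕ< p<K)
  ... | no  _   = spine (fromℕ N)

  leaf-cases : ∀ p → (Σ (toℕ p < K) λ p<K → node (leaf p) ≡ inj₁ (fromℕ< p<K))
                   ⊎ (toℕ p ≡ K × node (leaf p) ≡ inj₂ (fromℕ N))
  leaf-cases p with toℕ p <? K
  ... | yes p<K = inj₁ (p<K , node-leg _)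
  ... | no  p≮K = inj₂ (≤-antisym (s≤s⁻¹ (toℕ<n p)) (≮⇒≥ p≮K) , node-spine _)

  leaf-degree : ∀ p → tdeg caterpillar (leaf p) ≤ 1
  leaf-degree p with leaf-cases p
  ... | inj₁ (p<K , e) = ≤-reflexive (trans (tdeg-node (leaf p)) (trans (cong nodeDegree e) (leg-degree (fromℕ< p<K))))
  ... | inj₂ (_ , e)   = ≤-reflexive (trans (tdeg-node (leaf p)) (trans (cong nodeDegree e) last-spine-degree))

  leaf-injective : ∀ p q → leaf p ≡ leaf q → p ≡ q
  leaf-injective p q e with leaf-cases p | leaf-cases q | cong node e
  ... | inj₁ (p<K , ep) | inj₁ (q<K , eq) | e′ =
    toℕ-injective (trans (sym (toℕ-fromℕ< p<K)) (trans (cong toℕ (inj₁-injective (trans (sym ep) (trans e′ eq)))) (toℕ-fromℕ< q<K)))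
  ... | inj₁ (_ , ep)   | inj₂ (_ , eq)   | e′ with trans (sym ep) (trans e′ eq)
  ...   | ()
  leaf-injective p q e | inj₂ (_ , ep) | inj₁ (_ , eq) | e′ with trans (sym ep) (trans e′ eq)
  ...   | ()
  leaf-injective p q e | inj₂ (p≡K , _) | inj₂ (q≡K , _) | _ = toℕ-injective (trans p≡K (sym q≡K))

  leaf-or-internal : ∀ a → (∃ λ p → leaf p ≡ a) ⊎ tdeg caterpillar a ≡ 3
  leaf-or-internal a = by-node (node a) refl
    where
    by-node : ∀ p → node a ≡ p → (∃ λ p → leaf p ≡ a) ⊎ tdeg caterpillar a ≡ 3
    by-node (inj₁ i) node-a = inj₁ (inject₁ i , node-injective (trans leg-i (sym node-a)))
      where
      leg-i : node (leaf (inject₁ i)) ≡ inj₁ i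
      leg-i with leaf-cases (inject₁ i)
      ... | inj₁ (lt , e)  = trans e (cong inj₁ (toℕ-injective (trans (toℕ-fromℕ< lt) (toℕ-inject₁ i))))
      ... | inj₂ (i≡K , _) = ⊥-elim (<-irrefl (trans (sym (toℕ-inject₁ i)) i≡K) (toℕ<n i))
    by-node (inj₂ j) node-a with suc (toℕ j) <? K
    ... | yes j+1<K = inj₂ (trans (tdeg-node a) (trans (cong nodeDegree node-a) (internal-degree j j+1<K)))
    ... | no  j+1≮K = inj₁ (fromℕ K , node-injective (trans last (sym node-a)))
      where
      j≡N : j ≡ fromℕ N
      j≡N = toℕ-injective (trans (≤-antisym (s≤s⁻¹ (toℕ<n j)) (s≤s⁻¹ (≮⇒≥ j+1≮K))) (sym (toℕ-fromℕ N)))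
      last : node (leaf (fromℕ K)) ≡ inj₂ j
      last with leaf-cases (fromℕ K)
      ... | inj₁ (lt , _) = ⊥-elim (<-irrefl (toℕ-fromℕ K) lt)
      ... | inj₂ (_ , e)  = trans e (cong inj₂ (sym j≡N))

  SameNodeEdge : Node → Node → Node → Node → Set
  SameNodeEdge p q p′ q′ = (p ≡ p′ × q ≡ q′) ⊎ (p ≡ q′ × q ≡ p′)

  swap-edge : ∀ {p q p′ q′} → SameNodeEdge p q q′ p′ → SameNodeEdge p q p′ q′
  swap-edge (inj₁ e) = inj₂ e
  swap-edge (inj₂ e) = inj₁ e

  reverse-edge : ∀ {p q p′ q′} → SameNodeEdge q p p′ q′ → SameNodeEdge p q p′ q′
  reverse-edge (inj₁ (e₁ , e₂)) = inj₂ (e₂ , e₁)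
  reverse-edge (inj₂ (e₁ , e₂)) = inj₁ (e₂ , e₁)

  lift-separation : (colour : Node → Bool) {u v : Fin M} {p′ q′ : Node} → node u ≡ p′ → node v ≡ q′ →
    (∀ p q → nodeAdj p q ≡ true → ¬ SameNodeEdge p q p′ q′ → colour p ≡ colour q) →
    colour p′ ≢ colour q′ → Separation u v
  lift-separation colour {u} {v} {p′} {q′} node-u node-v constant separates = record
    { colour    = colour ∘ node
    ; constant  = λ a b ab other → constant (node a) (node b) ab (other ∘ lower)
    ; separates = separates ∘ subst₂ (λ p q → colour p ≡ colour q) node-u node-v }
    where
    lower : ∀ {a b} → SameNodeEdge (node a) (node b) p′ q′ → SameEdge a b u v
    lower (inj₁ (e₁ , e₂)) = inj₁ (node-injective (trans e₁ (sym node-u)) , node-injective (trans e₂ (sym node-v)))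
    lower (inj₂ (e₁ , e₂)) = inj₂ (node-injective (trans e₁ (sym node-v)) , node-injective (trans e₂ (sym node-u)))

  -- Being the leg ℓ_x separates the edge from ℓ_x to its spine node.
  legColour : Fin K → Node → Bool
  legColour x (inj₁ z) = toℕ z ≡ᵇ toℕ x
  legColour x (inj₂ _) = false

  legColour-constant : ∀ x y → legAdj (toℕ x) (toℕ y) ≡ true → ∀ p q → nodeAdj p q ≡ true →
    ¬ SameNodeEdge p q (inj₁ x) (inj₂ y) → legColour x p ≡ legColour x q
  legColour-constant x y xy (inj₁ z) (inj₁ w) () _
  legColour-constant x y xy (inj₂ w) (inj₂ z) _  _     = refl
  legColour-constant x y xy (inj₁ z) (inj₂ w) zw other =
    not-ℓx z w zw λ { refl refl → other (inj₁ (refl , refl)) }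
    where
    -- another edge ℓ_z s_w cannot have z = x, as ℓ_x hangs only at s_y
    not-ℓx : ∀ z w → legAdj (toℕ z) (toℕ w) ≡ true → (z ≡ x → w ≡ y → ⊥) → (toℕ z ≡ᵇ toℕ x) ≡ false
    not-ℓx z w zw other′ with toℕ z ≡ᵇ toℕ x in z≡x
    ... | false = refl
    ... | true with toℕ-injective {i = z} (≡ᵇ⇒≡′ z≡x)
    ...   | refl = ⊥-elim (other′ refl (toℕ-injective (legAdj-functional (toℕ x) (toℕ w) (toℕ y) zw xy)))
  legColour-constant x y xy (inj₂ w) (inj₁ z) wz other =
    sym (legColour-constant x y xy (inj₁ z) (inj₂ w) wz (other ∘ reverse-edge))

  legColour-leaf : ∀ x p → legColour x (node (leaf p)) ≡ (toℕ p ≡ᵇ toℕ x)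
  legColour-leaf x p with leaf-cases p
  ... | inj₁ (p<K , e) rewrite e | toℕ-fromℕ< p<K = refl
  ... | inj₂ (p≡K , e) rewrite e = sym (≡ᵇ-false (λ p≡x → <-irrefl (trans (sym p≡x) p≡K) (toℕ<n x)))

  -- For x = y + 1, lying beyond s_y separates the spine edge s_y s_x.
  spineColour : Fin K → Node → Bool
  spineColour x (inj₁ z) = toℕ x <ᵇ toℕ z
  spineColour x (inj₂ z) = toℕ x <ᵇ suc (toℕ z)

  beyond-step : ∀ (x y : Fin K) → toℕ x ≡ suc (toℕ y) → ∀ z → z ≢ toℕ y → (toℕ x <ᵇ suc (suc z)) ≡ (toℕ x <ᵇ suc z)
  beyond-step x y x≡y+1 z z≢y rewrite x≡y+1 = <ᵇ-suc {toℕ y} {z} z≢y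

  spineColour-constant : ∀ x y → toℕ x ≡ suc (toℕ y) → ∀ p q → nodeAdj p q ≡ true →
    ¬ SameNodeEdge p q (inj₂ x) (inj₂ y) → spineColour x p ≡ spineColour x q
  spineColour-constant x y x≡y+1 (inj₁ z) (inj₁ w) () _
  spineColour-constant x y x≡y+1 (inj₁ z) (inj₂ w) zw _ with legAdj-cases (toℕ z) (toℕ w) zw
  ... | inj₁ (z≡0 , w≡0) rewrite z≡0 | w≡0 | x≡y+1 = refl
  ... | inj₂ z≡w+1 rewrite z≡w+1 = refl
  spineColour-constant x y x≡y+1 (inj₂ w) (inj₁ z) wz other =
    sym (spineColour-constant x y x≡y+1 (inj₁ z) (inj₂ w) wz (other ∘ reverse-edge))
  spineColour-constant x y x≡y+1 (inj₂ w) (inj₂ z) wz other with toℕ w ≡ᵇ suc (toℕ z) in w≡z+1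
  ... | true  = trans (cong (λ W → toℕ x <ᵇ suc W) (≡ᵇ⇒≡′ w≡z+1)) (beyond-step x y x≡y+1 (toℕ z) z≢y)
    where
    z≢y : toℕ z ≢ toℕ y
    z≢y z≡y = other (inj₁ ( cong inj₂ (toℕ-injective (trans (≡ᵇ⇒≡′ w≡z+1) (trans (cong suc z≡y) (sym x≡y+1))))
                          , cong inj₂ (toℕ-injective z≡y)))
  ... | false = sym (trans (cong (λ Z → toℕ x <ᵇ suc Z) (≡ᵇ⇒≡′ wz)) (beyond-step x y x≡y+1 (toℕ w) w≢y))
    where
    w≢y : toℕ w ≢ toℕ y
    w≢y w≡y = other (inj₂ ( cong inj₂ (toℕ-injective w≡y)
                          , cong inj₂ (toℕ-injective (trans (≡ᵇ⇒≡′ wz) (trans (cong suc w≡y) (sym x≡y+1))))))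

  spineColour-leaf : ∀ x p → spineColour x (node (leaf p)) ≡ (toℕ x <ᵇ toℕ p)
  spineColour-leaf x p with leaf-cases p
  ... | inj₁ (p<K , e) rewrite e | toℕ-fromℕ< p<K = refl
  ... | inj₂ (p≡K , e) rewrite e | toℕ-fromℕ N = cong (toℕ x <ᵇ_) (sym p≡K)

  spineColour-separates : ∀ x y → toℕ x ≡ suc (toℕ y) → spineColour x (inj₂ x) ≢ spineColour x (inj₂ y)
  spineColour-separates x y x≡y+1 e =
    true≢false (trans (sym (<⇒<ᵇ′ (n<1+n (toℕ x)))) (trans e (trans (cong (_<ᵇ suc (toℕ y)) x≡y+1) (<ᵇ-irrefl (toℕ y)))))

  data LeafShape (colour : Fin M → Bool) : Set where
    single    : (c : ℕ) → (∀ p → colour (leaf p) ≡ (toℕ p ≡ᵇ c)) → LeafShape colour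
    threshold : (s : ℕ) → 1 ≤ s → (∀ p → colour (leaf p) ≡ (s <ᵇ toℕ p)) → LeafShape colour

  record EdgeCut (u v : Fin M) : Set where
    field
      separation : Separation u v
      shape      : LeafShape (Separation.colour separation)

  edge-cut : ∀ u v → tadj caterpillar u v ≡ true → EdgeCut u v
  edge-cut u v uv = by-nodes (node u) (node v) refl refl uv
    where
    positive : ∀ {X Y} → X ≡ suc Y → 1 ≤ X
    positive refl = s≤s z≤n

    leg-separates : ∀ x y → legColour x (inj₁ x) ≢ legColour x (inj₂ y)
    leg-separates x y e = true≢false (trans (sym (≡ᵇ-refl (toℕ x))) e)

    by-nodes : ∀ p q → node u ≡ p → node v ≡ q → nodeAdj p q ≡ true → EdgeCut u v
    by-nodes (inj₁ x) (inj₁ y) _ _ ()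
    by-nodes (inj₁ x) (inj₂ y) eu ev xy = record
      { separation = lift-separation (legColour x) eu ev (legColour-constant x y xy) (leg-separates x y)
      ; shape      = single (toℕ x) (legColour-leaf x) }
    by-nodes (inj₂ y) (inj₁ x) eu ev xy = record
      { separation = lift-separation (legColour x) eu ev
                       (λ p q pq other → legColour-constant x y xy p q pq (other ∘ swap-edge)) (leg-separates x y ∘ sym)
      ; shape      = single (toℕ x) (legColour-leaf x) }
    by-nodes (inj₂ x) (inj₂ y) eu ev xy with toℕ x ≡ᵇ suc (toℕ y) in x≡y+1
    ... | true  = record
      { separation = lift-separation (spineColour x) eu ev
                       (spineColour-constant x y (≡ᵇ⇒≡′ x≡y+1)) (spineColour-separates x y (≡ᵇ⇒≡′ x≡y+1))
      ; shape      = threshold (toℕ x) (positive (≡ᵇ⇒≡′ x≡y+1)) (spineColour-leaf x) }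
    ... | false = record
      { separation = lift-separation (spineColour y) eu ev
                       (λ p q pq other → spineColour-constant y x (≡ᵇ⇒≡′ xy) p q pq (other ∘ swap-edge))
                       (spineColour-separates y x (≡ᵇ⇒≡′ xy) ∘ sym)
      ; shape      = threshold (toℕ y) (positive (≡ᵇ⇒≡′ xy)) (spineColour-leaf y) }

module PositionCuts {N : ℕ} (G : Graph (suc (suc N))) (pos : Fin (suc (suc N)) → Fin (suc (suc N)))
  (pos-injective : Injective _≡_ _≡_ pos) (k : ℕ) (1≤k : 1 ≤ k)
  (degenerate : ∀ v → laterNbrs (complement G) pos v ≤ k) where

  open Traces G
  open OrderedCuts G pos k degenerate

  n : ℕ
  n = suc (suc N)

  -- Two traces are within the bound, as n ≥ 2 and k ≥ 1.
  2≤n^k : 2 ≤ n ^ k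
  2≤n^k = ≤-trans (s≤s (s≤s z≤n)) (subst (_≤ n ^ k) (*-identityʳ n) (^-monoʳ-≤ n 1≤k))

  vertexAt : Fin n → Fin n
  vertexAt p = proj₁ (injective⇒surjective pos pos-injective p)

  pos-vertexAt : ∀ p → pos (vertexAt p) ≡ p
  pos-vertexAt p = proj₂ (injective⇒surjective pos pos-injective p)

  -- The vertices at positions 0 and 1 lie at or before every threshold t ≥ 1.
  first second : Fin n
  first  = vertexAt zero
  second = vertexAt (suc zero)

  first≢second : first ≢ second
  first≢second first≡second with trans (sym (pos-vertexAt zero)) (trans (cong pos first≡second) (pos-vertexAt (suc zero)))
  ... | ()

  first-early : ∀ t → toℕ (pos first) ≤ t
  first-early t rewrite pos-vertexAt zero = z≤n

  second-early : ∀ t → 1 ≤ t → toℕ (pos second) ≤ t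
  second-early t 1≤t rewrite pos-vertexAt (suc zero) = 1≤t

  cutBoolCount-point : (A : Subset n) (s : Bool) (c : ℕ) →
    (∀ x → lookup A x ≡ agrees s (toℕ (pos x) ≡ᵇ c)) → cutBoolCount G A ≤ n ^ k
  cutBoolCount-point A true c A-at-c = ≤-trans (cutBoolCount-small-side A at-most-one) 2≤n^k
    where
    at-c : ∀ x → lookup A x ≡ true → toℕ (pos x) ≡ c
    at-c x x∈A = ≡ᵇ⇒≡′ (trans (sym (A-at-c x)) x∈A)
    at-most-one : Subsingleton (lookup A)
    at-most-one x y x∈A y∈A = pos-injective (toℕ-injective (trans (at-c x x∈A) (sym (at-c y y∈A))))
  cutBoolCount-point A false c A-off-c = ≤-trans (cutBoolCount-small-coside A at-most-one) 2≤n^k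
    where
    at-c : ∀ x → not (lookup A x) ≡ true → toℕ (pos x) ≡ c
    at-c x x∉A = ≡ᵇ⇒≡′ (trans (sym (not-involutive _)) (trans (cong not (sym (A-off-c x))) x∉A))
    at-most-one : Subsingleton (not ∘ lookup A)
    at-most-one x y x∉A y∉A = pos-injective (toℕ-injective (trans (at-c x x∉A) (sym (at-c y y∉A))))

  cutBoolCount-threshold : (A : Subset n) (s : Bool) (t : ℕ) → 1 ≤ t →
    (∀ x → lookup A x ≡ agrees s (t <ᵇ toℕ (pos x))) → cutBoolCount G A ≤ n ^ k
  cutBoolCount-threshold A true t 1≤t A-after-t =
    cutBoolCount-final A first second first≢second
      (outside first (first-early t)) (outside second (second-early t 1≤t))
      1≤k A-last
    where
    outside : ∀ x → toℕ (pos x) ≤ t → lookup A x ≡ false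
    outside x x≤t = trans (A-after-t x) (<ᵇ-false x≤t)
    A-last : ∀ x y → lookup A x ≡ true → lookup A y ≡ false → toℕ (pos y) < toℕ (pos x)
    A-last x y x∈A y∉A = ≤-<-trans (<ᵇ-false⇒≥ (trans (sym (A-after-t y)) y∉A)) (<ᵇ⇒<′ (trans (sym (A-after-t x)) x∈A))
  cutBoolCount-threshold A false t 1≤t A-upto-t =
    cutBoolCount-initial A first second first≢second
      (inside first (first-early t)) (inside second (second-early t 1≤t))
      1≤k A-first
    where
    inside : ∀ x → toℕ (pos x) ≤ t → lookup A x ≡ true
    inside x x≤t = trans (A-upto-t x) (cong not (<ᵇ-false x≤t))
    A-first : ∀ x y → lookup A x ≡ true → lookup A y ≡ false → toℕ (pos x) < toℕ (pos y)
    A-first x y x∈A y∉A = ≤-<-trans (<ᵇ-false⇒≥ (not-injective (trans (sym (A-upto-t x)) x∈A)))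
                                   (<ᵇ⇒<′ (not-injective (trans (sym (A-upto-t y)) y∉A)))

caterpillarTree : ∀ N (pos : Fin (suc (suc N)) → Fin (suc (suc N))) → Injective _≡_ _≡_ pos →
  DecompTree (suc (suc N))
caterpillarTree N pos pos-injective = record
  { m       = M
  ; T       = caterpillar
  ; isTree  = connected , (λ u v uv → bridge (EdgeCut.separation (edge-cut u v uv)))
  ; degrees = leaf-or-degree-three
  ; δ       = leaf ∘ pos
  ; δ-inj   = pos-injective ∘ leaf-injective _ _
  ; δ-leaf  = leaf-degree ∘ pos
  ; δ-onto  = onto }
  where
  open Caterpillar N
  open Walks caterpillar

  leaf-or-degree-three : ∀ a → IsLeaf caterpillar a ⊎ tdeg caterpillar a ≡ 3
  leaf-or-degree-three a with leaf-or-internal a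
  ... | inj₁ (p , refl) = inj₁ (leaf-degree p)
  ... | inj₂ internal   = inj₂ internal

  onto : ∀ a → IsLeaf caterpillar a → ∃ λ x → leaf (pos x) ≡ a
  onto a a-leaf with leaf-or-internal a
  ... | inj₂ internal with subst (_≤ 1) internal a-leaf
  ...   | s≤s ()
  onto a a-leaf | inj₁ (p , refl) with injective⇒surjective pos pos-injective p
  ...   | x , refl = x , refl

caterpillar-width : ∀ N k → 1 ≤ k → (G : Graph (suc (suc N))) (pos : Fin (suc (suc N)) → Fin (suc (suc N)))
  (pos-injective : Injective _≡_ _≡_ pos) → (∀ v → laterNbrs (complement G) pos v ≤ k) →
  BoolWidthAtMostLog G (caterpillarTree N pos pos-injective) (suc (suc N) ^ k)
caterpillar-width N k 1≤k G pos pos-injective degenerate u v uv A is-cut = by-shape (EdgeCut.shape cut)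
  where
  open Caterpillar N
  open Walks caterpillar
  open PositionCuts G pos pos-injective k 1≤k degenerate

  cut : EdgeCut u v
  cut = edge-cut u v uv

  S : Separation u v
  S = EdgeCut.separation cut
  open Separation S

  side : ∀ x → lookup A x ≡ agrees (colour u) (colour (leaf (pos x)))
  side = cut-by-colour S connected (leaf ∘ pos) A is-cut

  by-shape : LeafShape colour → cutBoolCount G A ≤ suc (suc N) ^ k
  by-shape (single c on-leaves) =
    cutBoolCount-point A (colour u) c (λ x → trans (side x) (cong (agrees (colour u)) (on-leaves (pos x))))
  by-shape (threshold t 1≤t on-leaves) =
    cutBoolCount-threshold A (colour u) t 1≤t (λ x → trans (side x) (cong (agrees (colour u)) (on-leaves (pos x))))

singleNodeTree : DecompTree 1
singleNodeTree = record
  { m       = 1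
  ; T       = record { tadj = λ _ _ → false ; tsym = λ _ _ → refl ; tirrefl = λ _ → refl }
  ; isTree  = (λ { zero zero → here }) , (λ _ _ ())
  ; degrees = λ _ → inj₁ z≤n
  ; δ       = λ x → x
  ; δ-inj   = λ e → e
  ; δ-leaf  = λ _ → z≤n
  ; δ-onto  = λ a _ → a , refl }

mainTheorem9 : (k n : ℕ) → 1 ≤ k → 1 ≤ n → (G : Graph n) →
    Degenerate k (complement G) →
    Σ (DecompTree n) λ D → BoolWidthAtMostLog G D (n ^ k)
mainTheorem9 k zero          _   ()  G _
mainTheorem9 k (suc zero)    _   _   G _ = singleNodeTree , (λ _ _ ())
mainTheorem9 k (suc (suc N)) 1≤k _   G (pos , pos-injective , degenerate) =
  caterpillarTree N pos pos-injective , caterpillar-width N k 1≤k G pos pos-injective degenerate
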